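{- Let $X$ be a finite simplicial complex with vertices $v_1,\dots,v_m$ and let $\varepsilon\in\mathbb{Z}_2^m$ be a dalmatian colouring. Then for every $n$, the generators of the horizontal homology $\mathrm{H}^h_n(X,\varepsilon)$ are in bijection with the critical $n$-dimensional simplices of the Morse matching $I(X,\varepsilon)$; more precisely, the homology classes of the critical $n$-simplices form a basis of $\mathrm{H}^h_n(X,\varepsilon)$.
   Context: $\mathbb{F}$ is the field with two elements, $C_*(X)$ the simplicial chain complex over $\mathbb{F}$. A colouring $\varepsilon\in\mathbb{Z}_2^m$ colours $v_i$ black if $\varepsilon(i)=1$, white otherwise. The horizontal differential $\partial_h$ sends a simplex $\sigma$ to the sum of the faces $\sigma\setminus\{v\}$ over black vertices $v\in\sigma$; $\mathrm{H}^h(X,\varepsilon)$ is the homology of $(C_*(X),\partial_h)$ and $\mathrm{H}^h_n$ its part in simplex dimension $n$. The face poset $\mathcal{P}(X)$ is the directed graph on nonempty simplices with an edge $\sigma\to\tau$ when $\tau\subset\sigma$ has codimension one; $I(X,\varepsilon)\subseteq\mathcal{P}(X)$ consists of the edges $\sigma\to\tau$ with $\tau$ appearing in $\partial_h(\sigma)$. A colouring $\varepsilon\ne(0,\dots,0)$ is dalmatian if whenever two simplices $\sigma,\tau$ intersect, $\sigma\cup\tau$ has at most one black vertex; for such $\varepsilon$, $I(X,\varepsilon)$ is a discrete Morse matching (a set of pairwise disjoint edges whose reversal creates no directed cycle). A simplex is critical for $I(X,\varepsilon)$ if it is not an endpoint of any edge of $I(X,\varepsilon)$. -}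

module Defs where

open import Data.Nat using (ℕ; zero; suc; _≤_; _≡ᵇ_)
open import Data.Bool using (Bool; true; false; _∧_; _xor_; not; if_then_else_)
open import Data.Fin using (Fin)
open import Data.Fin.Subset using (Subset; inside; outside; ⁅_⁆; _∈_; _∉_; _⊆_; _∩_; _∪_; _-_; ∣_∣; Nonempty)
open import Data.Vec using (lookup)
open import Data.Vec.Properties using (≡-dec)
open import Data.List using (foldr; map; allFin)
open import Data.Product using (Σ; ∃; ∃-syntax; _×_)
open import Relation.Nullary using (¬_; does)
open import Relation.Binary.PropositionalEquality using (_≡_; _≢_)
import Data.Bool as B

record SimplicialComplex (m : ℕ) : Set where
  field
    isFace   : Subset m → Bool
    downward : ∀ {σ τ} → σ ⊆ τ → isFace τ ≡ true → isFace σ ≡ true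
    vertices : ∀ (i : Fin m) → isFace ⁅ i ⁆ ≡ true
open SimplicialComplex public

-- A colouring ε ∈ ℤ₂^m, viewed as the subset of black vertices.
Colouring : ℕ → Set
Colouring m = Subset m

Simplex : ∀ {m} → SimplicialComplex m → Subset m → Set
Simplex X σ = isFace X σ ≡ true × Nonempty σ

IsNSimplex : ∀ {m} → SimplicialComplex m → ℕ → Subset m → Set
IsNSimplex X n σ = isFace X σ ≡ true × ∣ σ ∣ ≡ suc n

Dalmatian : ∀ {m} → SimplicialComplex m → Colouring m → Set
Dalmatian {m} X ε =
  (ε ≢ Data.Vec.replicate m outside) ×
  (∀ σ τ → isFace X σ ≡ true → isFace X τ ≡ true → Nonempty (σ ∩ τ) →
     ∣ (σ ∪ τ) ∩ ε ∣ ≤ 1)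

-- Chains over 𝔽 = 𝔽₂: a chain is the function giving the coefficient of each subset.
Chain : ℕ → Set
Chain m = Subset m → Bool

IsChain : ∀ {m} → SimplicialComplex m → ℕ → Chain m → Set
IsChain X n c = ∀ σ → c σ ≡ true → IsNSimplex X n σ

-- Horizontal differential ∂_h: ∂_h σ = Σ_{v ∈ σ black} σ∖{v}, extended linearly
-- (non-augmented: the empty face is discarded).  Written coefficientwise: the
-- coefficient of τ in ∂_h c is the sum over black v ∉ τ of the coefficient of τ ∪ {v} in c.
∂h : ∀ {m} → Colouring m → Chain m → Chain m
∂h {m} ε c τ =
  if ∣ τ ∣ ≡ᵇ 0 then false
  else foldr _xor_ false
         (map (λ v → lookup ε v ∧ (not (lookup τ v) ∧ c (τ ∪ ⁅ v ⁆))) (allFin m))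

_⊕_ : ∀ {m} → Chain m → Chain m → Chain m
(c ⊕ d) σ = c σ xor d σ

⟦_⟧ : ∀ {m} → Subset m → Chain m
⟦ σ ⟧ τ = does (≡-dec B._≟_ τ σ)

IsCycle : ∀ {m} → Colouring m → Chain m → Set
IsCycle ε c = ∀ τ → ∂h ε c τ ≡ false

InI : ∀ {m} → SimplicialComplex m → Colouring m → Subset m → Subset m → Set
InI X ε σ τ = Simplex X σ × Nonempty τ × Σ (Fin _) (λ v → v ∈ σ × v ∈ ε × (σ - v) ≡ τ)

Critical : ∀ {m} → SimplicialComplex m → Colouring m → Subset m → Set
Critical X ε σ =
  Simplex X σ ×
  (¬ (∃[ τ ] InI X ε σ τ)) ×
  (¬ (∃[ ρ ] InI X ε ρ σ))

-- For a dalmatian colouring, two intersecting faces carry the same black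
-- vertex, if any. Hence ∂h of a chain of faces, evaluated at the target τ of
-- a matching edge σ → τ, is just the coefficient of σ; and dually the
-- horizontal coboundary δh c, evaluated at the source ρ of an edge ρ → σ, is
-- the coefficient of σ. So a cycle z vanishes on every source of an edge,
-- z + ∂h (δh z) kills z on every target of an edge, and what remains is
-- supported on critical simplices. Conversely, every simplex in the support of
-- a boundary ∂h w is the target of the edge coming from w, so is not critical.
module Submission where

open import Defs
open import Data.Nat using (ℕ; suc; _≤_; _<_; _≡ᵇ_; s≤s; z≤n)
open import Data.Nat.Properties using (≤-trans)
open import Data.Bool using (Bool; true; false; _∧_; _xor_; not; if_then_else_)
open import Data.Bool.Properties using (¬-not; ∨-identityʳ; xor-assoc; xor-same; xor-identityʳ)
open import Data.Fin using (Fin; _≟_)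
open import Data.Fin.Properties using (0≢1+n; suc-injective)
open import Data.Fin.Subset using (Subset; ⁅_⁆; _∪_; _-_; ∣_∣; Nonempty; _∈_; _∉_; inside; outside)
open import Data.Fin.Subset.Properties
  using (x∈⁅x⁆; x∈p∪q⁺; x∈p∩q⁺; p─q⊆p; p─⊥≡p; ∪-identityʳ; x∈p∧x≢y⇒x∈p-y; x∈p⇒∣p-x∣<∣p∣)
open import Data.Vec using (_∷_; lookup; here; there)
open import Data.Vec.Properties using (≡-dec; []=⇒lookup; lookup⇒[]=)
open import Data.List using (foldr; map; allFin)
open import Data.List.Properties using (map-tabulate)
open import Data.Product using (Σ; ∃; ∃-syntax; _×_; _,_; proj₁; proj₂)
open import Data.Sum using (inj₁; inj₂)
open import Function using (_∘_)
open import Relation.Nullary using (¬_; yes; no; contradiction)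
open import Relation.Binary.PropositionalEquality using (_≡_; refl; sym; trans; cong; cong₂; subst; module ≡-Reasoning)
import Data.Bool as B

private
  variable
    m : ℕ
    p : Subset m
    x y : Fin m

∧-true : ∀ {a b} → a ∧ b ≡ true → a ≡ true × b ≡ true
∧-true {true} {true} _ = refl , refl

lookup≡false⇒∉ : lookup p x ≡ false → x ∉ p
lookup≡false⇒∉ px≡false x∈p with () ← trans (sym px≡false) ([]=⇒lookup x∈p)

∉⇒lookup≡false : x ∉ p → lookup p x ≡ false
∉⇒lookup≡false {x = x} {p = p} x∉p = ¬-not (x∉p ∘ lookup⇒[]= x p)

x∈p∪⁅x⁆ : ∀ (p : Subset m) x → x ∈ p ∪ ⁅ x ⁆
x∈p∪⁅x⁆ p x = x∈p∪q⁺ (inj₂ (x∈⁅x⁆ x))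

x∉p-x : ∀ (p : Subset m) x → x ∉ p - x
x∉p-x (_ ∷ p) Fin.zero ()
x∉p-x (_ ∷ p) (Fin.suc x) (there x∈p-x) = x∉p-x p x x∈p-x

p-x∪⁅x⁆≡p : x ∈ p → (p - x) ∪ ⁅ x ⁆ ≡ p
p-x∪⁅x⁆≡p {p = inside ∷ p} here = cong (inside ∷_) (trans (∪-identityʳ _) (p─⊥≡p p))
p-x∪⁅x⁆≡p {p = b ∷ p} (there x∈p) = cong₂ _∷_ (∨-identityʳ b) (p-x∪⁅x⁆≡p x∈p)

p∪⁅x⁆-x≡p : x ∉ p → (p ∪ ⁅ x ⁆) - x ≡ p
p∪⁅x⁆-x≡p {x = Fin.zero} {p = outside ∷ p} _ = cong (outside ∷_) (trans (p─⊥≡p _) (∪-identityʳ p))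
p∪⁅x⁆-x≡p {x = Fin.zero} {p = inside ∷ p} x∉p = contradiction here x∉p
p∪⁅x⁆-x≡p {x = Fin.suc x} {p = b ∷ p} x∉p =
  cong₂ _∷_ (∨-identityʳ b) (p∪⁅x⁆-x≡p (x∉p ∘ there))

x∈p⇒∣p∣≡1+∣p-x∣ : x ∈ p → ∣ p ∣ ≡ suc ∣ p - x ∣
x∈p⇒∣p∣≡1+∣p-x∣ {p = inside ∷ p} here = cong (suc ∘ ∣_∣) (sym (p─⊥≡p p))
x∈p⇒∣p∣≡1+∣p-x∣ {p = inside ∷ p} (there x∈p) = cong suc (x∈p⇒∣p∣≡1+∣p-x∣ x∈p)
x∈p⇒∣p∣≡1+∣p-x∣ {p = outside ∷ p} (there x∈p) = x∈p⇒∣p∣≡1+∣p-x∣ x∈p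

Nonempty⇒∣p∣≢ᵇ0 : Nonempty p → (∣ p ∣ ≡ᵇ 0) ≡ false
Nonempty⇒∣p∣≢ᵇ0 (x , x∈p) rewrite x∈p⇒∣p∣≡1+∣p-x∣ x∈p = refl

∣p∣≢ᵇ0⇒Nonempty : ∀ (p : Subset m) → (∣ p ∣ ≡ᵇ 0) ≡ false → Nonempty p
∣p∣≢ᵇ0⇒Nonempty (inside ∷ p) _ = Fin.zero , here
∣p∣≢ᵇ0⇒Nonempty (outside ∷ p) ∣p∣≢0 with x , x∈p ← ∣p∣≢ᵇ0⇒Nonempty p ∣p∣≢0 = Fin.suc x , there x∈p

∣p∣≤1⇒x∈p⇒y∈p⇒x≡y : ∣ p ∣ ≤ 1 → x ∈ p → y ∈ p → x ≡ y
∣p∣≤1⇒x∈p⇒y∈p⇒x≡y {p = p} {x = x} {y = y} ∣p∣≤1 x∈p y∈p with x ≟ y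
... | yes x≡y = x≡y
... | no x≢y = contradiction (≤-trans (s≤s 0<∣p-x∣) (≤-trans (x∈p⇒∣p-x∣<∣p∣ x∈p) ∣p∣≤1)) λ { (s≤s ()) }
  where
  0<∣p-x∣ : 0 < ∣ p - x ∣
  0<∣p-x∣ = ≤-trans (s≤s z≤n) (x∈p⇒∣p-x∣<∣p∣ (x∈p∧x≢y⇒x∈p-y y∈p (x≢y ∘ sym)))

-- The 𝔽₂-sum of f, spelled exactly as inside ∂h so that ∂h unfolds to it.
⨁ : (Fin m → Bool) → Bool
⨁ {m} f = foldr _xor_ false (map f (allFin m))

⨁-suc : ∀ (f : Fin (suc m) → Bool) → ⨁ f ≡ f Fin.zero xor ⨁ (f ∘ Fin.suc)
⨁-suc f = cong (λ fs → f Fin.zero xor foldr _xor_ false fs)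
  (trans (map-tabulate Fin.suc f) (sym (map-tabulate (λ i → i) (f ∘ Fin.suc))))

⨁-true : ∀ (f : Fin m → Bool) → ⨁ f ≡ true → ∃ λ i → f i ≡ true
⨁-true {suc m} f ⨁f≡true = split (trans (sym (⨁-suc f)) ⨁f≡true)
  where
  split : f Fin.zero xor ⨁ (f ∘ Fin.suc) ≡ true → ∃ λ i → f i ≡ true
  split h with f Fin.zero in f0
  ... | true = Fin.zero , f0
  ... | false = let i , fi = ⨁-true (f ∘ Fin.suc) h in Fin.suc i , fi

⨁-single : ∀ (f : Fin m → Bool) j → (∀ i → f i ≡ true → i ≡ j) → ⨁ f ≡ f j
⨁-single {suc m} f Fin.zero only-j = begin
  ⨁ f                                        ≡⟨ ⨁-suc f ⟩
  f Fin.zero xor ⨁ (f ∘ Fin.suc)             ≡⟨ cong (f Fin.zero xor_) rest≡false ⟩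
  f Fin.zero xor false                       ≡⟨ xor-identityʳ _ ⟩
  f Fin.zero                                 ∎
  where
  open ≡-Reasoning
  rest≡false : ⨁ (f ∘ Fin.suc) ≡ false
  rest≡false = ¬-not λ rest≡true →
    let i , fi = ⨁-true (f ∘ Fin.suc) rest≡true in 0≢1+n (sym (only-j (Fin.suc i) fi))
⨁-single {suc m} f (Fin.suc j) only-j = begin
  ⨁ f                                        ≡⟨ ⨁-suc f ⟩
  f Fin.zero xor ⨁ (f ∘ Fin.suc)             ≡⟨ cong (_xor ⨁ (f ∘ Fin.suc)) f0≡false ⟩
  ⨁ (f ∘ Fin.suc)                            ≡⟨ ⨁-single (f ∘ Fin.suc) j (λ i fi → suc-injective (only-j (Fin.suc i) fi)) ⟩
  f (Fin.suc j)                              ∎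
  where
  open ≡-Reasoning
  f0≡false : f Fin.zero ≡ false
  f0≡false = ¬-not λ f0≡true → 0≢1+n (only-j Fin.zero f0≡true)

⊕-cancelʳ : ∀ (c d : Chain m) τ → c τ ≡ ((c ⊕ d) ⊕ d) τ
⊕-cancelʳ c d τ = sym (begin
  (c τ xor d τ) xor d τ   ≡⟨ xor-assoc (c τ) (d τ) (d τ) ⟩
  c τ xor (d τ xor d τ)   ≡⟨ cong (c τ xor_) (xor-same (d τ)) ⟩
  c τ xor false           ≡⟨ xor-identityʳ (c τ) ⟩
  c τ                     ∎)
  where open ≡-Reasoning

⟦⟧-true : ∀ {σ ρ : Subset m} → ⟦ σ ⟧ ρ ≡ true → ρ ≡ σ
⟦⟧-true {σ = σ} {ρ} ⟦σ⟧ρ with ≡-dec B._≟_ ρ σ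
... | yes ρ≡σ = ρ≡σ

coface-term : Colouring m → Chain m → Subset m → Fin m → Bool
coface-term ε c τ v = lookup ε v ∧ (not (lookup τ v) ∧ c (τ ∪ ⁅ v ⁆))

∂h-nonempty : ∀ (ε : Colouring m) c {τ} → Nonempty τ → ∂h ε c τ ≡ ⨁ (coface-term ε c τ)
∂h-nonempty ε c {τ} τ≢∅ = cong (λ b → if b then false else ⨁ (coface-term ε c τ)) (Nonempty⇒∣p∣≢ᵇ0 τ≢∅)

coface-term-true : ∀ (ε : Colouring m) c τ v → coface-term ε c τ v ≡ true →
  v ∈ ε × v ∉ τ × c (τ ∪ ⁅ v ⁆) ≡ true
coface-term-true ε c τ v t with lookup ε v in εv | lookup τ v in τv
... | true | false = lookup⇒[]= v ε εv , lookup≡false⇒∉ τv , t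

facet-term : Colouring m → Chain m → Subset m → Fin m → Bool
facet-term ε c ρ u = lookup ε u ∧ (lookup ρ u ∧ c (ρ - u))

facet-term-true : ∀ (ε : Colouring m) c ρ u → facet-term ε c ρ u ≡ true →
  u ∈ ε × u ∈ ρ × c (ρ - u) ≡ true
facet-term-true ε c ρ u t with lookup ε u in εu | lookup ρ u in ρu
... | true | true = lookup⇒[]= u ε εu , lookup⇒[]= u ρ ρu , t

-- δh is the horizontal coboundary, cut down to the faces of X; it is the
-- chain homotopy deforming a cycle onto its critical part.
δh : SimplicialComplex m → Colouring m → Chain m → Chain m
δh X ε c ρ = isFace X ρ ∧ ⨁ (facet-term ε c ρ)

IsFaceChain : SimplicialComplex m → Chain m → Set
IsFaceChain X c = ∀ ρ → c ρ ≡ true → isFace X ρ ≡ true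

module _ (X : SimplicialComplex m) (ε : Colouring m) where

  chain⇒faceChain : ∀ {n c} → IsChain X n c → IsFaceChain X c
  chain⇒faceChain cₙ ρ cρ = proj₁ (cₙ ρ cρ)

  coface-matched : ∀ {τ v} → isFace X (τ ∪ ⁅ v ⁆) ≡ true → Nonempty τ → v ∈ ε → v ∉ τ →
    InI X ε (τ ∪ ⁅ v ⁆) τ
  coface-matched {τ} {v} face τ≢∅ v∈ε v∉τ =
    (face , v , x∈p∪⁅x⁆ τ v) , τ≢∅ , v , x∈p∪⁅x⁆ τ v , v∈ε , p∪⁅x⁆-x≡p v∉τ

  ∂h-true⇒matched : ∀ {c τ} → IsFaceChain X c → ∂h ε c τ ≡ true → ∃ λ ρ → InI X ε ρ τ × c ρ ≡ true
  ∂h-true⇒matched {c} {τ} c⊆X ∂cτ with ∣ τ ∣ ≡ᵇ 0 in ∣τ∣≢0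
  ... | false with v , t ← ⨁-true (coface-term ε c τ) ∂cτ
              with v∈ε , v∉τ , cρ ← coface-term-true ε c τ v t =
    τ ∪ ⁅ v ⁆ , coface-matched (c⊆X _ cρ) (∣p∣≢ᵇ0⇒Nonempty τ ∣τ∣≢0) v∈ε v∉τ , cρ

  critical⇒cycle : ∀ {σ} → Critical X ε σ → IsCycle ε ⟦ σ ⟧
  critical⇒cycle {σ} ((σ∈X , _) , no-out , _) τ = ¬-not λ ∂στ →
    let ρ , ρ→τ , ⟦σ⟧ρ = ∂h-true⇒matched ⟦σ⟧⊆X ∂στ
    in no-out (τ , subst (λ ρ → InI X ε ρ τ) (⟦⟧-true ⟦σ⟧ρ) ρ→τ)
    where
    ⟦σ⟧⊆X : IsFaceChain X ⟦ σ ⟧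
    ⟦σ⟧⊆X ρ ⟦σ⟧ρ = subst (λ ρ → isFace X ρ ≡ true) (sym (⟦⟧-true ⟦σ⟧ρ)) σ∈X

  boundary⇒not-critical : ∀ {w σ} → IsFaceChain X w → ∂h ε w σ ≡ true → ¬ Critical X ε σ
  boundary⇒not-critical w⊆X ∂wσ (_ , _ , no-in) =
    let ρ , ρ→σ , _ = ∂h-true⇒matched w⊆X ∂wσ in no-in (ρ , ρ→σ)

  δh-faceChain : ∀ {c} → IsFaceChain X (δh X ε c)
  δh-faceChain ρ δcρ = proj₁ (∧-true δcρ)

  δh-chain : ∀ {n c} → IsChain X n c → IsChain X (suc n) (δh X ε c)
  δh-chain {c = c} cₙ ρ δcρ
    with u , t ← ⨁-true (facet-term ε c ρ) (proj₂ (∧-true {isFace X ρ} δcρ))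
    with _ , u∈ρ , cρ-u ← facet-term-true ε c ρ u t =
    δh-faceChain {c} ρ δcρ , trans (x∈p⇒∣p∣≡1+∣p-x∣ u∈ρ) (cong suc (proj₂ (cₙ (ρ - u) cρ-u)))

  module _ (D : Dalmatian X ε) where

    black-unique : ∀ {σ τ x u v} → isFace X σ ≡ true → isFace X τ ≡ true → x ∈ σ → x ∈ τ →
      u ∈ σ → u ∈ ε → v ∈ τ → v ∈ ε → u ≡ v
    black-unique {σ} {τ} {x} σ∈X τ∈X x∈σ x∈τ u∈σ u∈ε v∈τ v∈ε =
      ∣p∣≤1⇒x∈p⇒y∈p⇒x≡y (proj₂ D σ τ σ∈X τ∈X (x , x∈p∩q⁺ (x∈σ , x∈τ)))
        (x∈p∩q⁺ (x∈p∪q⁺ (inj₁ u∈σ) , u∈ε)) (x∈p∩q⁺ (x∈p∪q⁺ (inj₂ v∈τ) , v∈ε))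

    ∂h-matched : ∀ {c σ τ} → IsFaceChain X c → InI X ε σ τ → ∂h ε c τ ≡ c σ
    ∂h-matched {c} {σ} c⊆X ((σ∈X , _) , τ≢∅@(x , x∈σ-v) , v , v∈σ , v∈ε , refl) = begin
      ∂h ε c (σ - v)                 ≡⟨ ∂h-nonempty ε c τ≢∅ ⟩
      ⨁ (coface-term ε c (σ - v))    ≡⟨ ⨁-single _ v only-v ⟩
      coface-term ε c (σ - v) v      ≡⟨ term-v ⟩
      c σ                            ∎
      where
      open ≡-Reasoning
      only-v : ∀ i → coface-term ε c (σ - v) i ≡ true → i ≡ v
      only-v i t with i∈ε , _ , cρ ← coface-term-true ε c (σ - v) i t =
        sym (black-unique σ∈X (c⊆X _ cρ) (p─q⊆p σ _ x∈σ-v) (x∈p∪q⁺ (inj₁ x∈σ-v)) v∈σ v∈ε (x∈p∪⁅x⁆ _ i) i∈ε)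
      term-v : coface-term ε c (σ - v) v ≡ c σ
      term-v rewrite []=⇒lookup v∈ε | ∉⇒lookup≡false (x∉p-x σ v) | p-x∪⁅x⁆≡p v∈σ = refl

    δh-matched : ∀ {c ρ σ} → InI X ε ρ σ → δh X ε c ρ ≡ c σ
    δh-matched {c} {ρ} ((ρ∈X , _) , _ , v , v∈ρ , v∈ε , refl) rewrite ρ∈X = begin
      ⨁ (facet-term ε c ρ)           ≡⟨ ⨁-single _ v only-v ⟩
      facet-term ε c ρ v             ≡⟨ term-v ⟩
      c (ρ - v)                      ∎
      where
      open ≡-Reasoning
      only-v : ∀ u → facet-term ε c ρ u ≡ true → u ≡ v
      only-v u t with u∈ε , u∈ρ , _ ← facet-term-true ε c ρ u t =
        black-unique ρ∈X ρ∈X v∈ρ v∈ρ u∈ρ u∈ε v∈ρ v∈ε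
      term-v : facet-term ε c ρ v ≡ c (ρ - v)
      term-v rewrite []=⇒lookup v∈ε | []=⇒lookup v∈ρ = refl

    ∂h∘δh-matched : ∀ {c ρ σ} → InI X ε ρ σ → ∂h ε (δh X ε c) σ ≡ c σ
    ∂h∘δh-matched {c} ρ→σ = trans (∂h-matched (δh-faceChain {c}) ρ→σ) (δh-matched ρ→σ)

    ∂h∘δh-true : ∀ {c σ} → ∂h ε (δh X ε c) σ ≡ true → c σ ≡ true
    ∂h∘δh-true {c} ∂δcσ with _ , ρ→σ , _ ← ∂h-true⇒matched (δh-faceChain {c}) ∂δcσ =
      trans (sym (∂h∘δh-matched {c} ρ→σ)) ∂δcσ

    cycle-vanishes-on-sources : ∀ {z σ τ} → IsFaceChain X z → IsCycle ε z → InI X ε σ τ → z σ ≡ false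
    cycle-vanishes-on-sources z⊆X z-cycle σ→τ = trans (sym (∂h-matched z⊆X σ→τ)) (z-cycle _)

    cycle+∂δh-critical : ∀ {n z σ} → IsChain X n z → IsCycle ε z →
      (z ⊕ ∂h ε (δh X ε z)) σ ≡ true → Critical X ε σ × IsNSimplex X n σ
    cycle+∂δh-critical {n} {z} {σ} zₙ z-cycle zσ+∂δzσ with z σ in zσ | ∂h ε (δh X ε z) σ in ∂δzσ
    ... | true | false = ((σ∈X , ∣p∣≢ᵇ0⇒Nonempty σ (cong (_≡ᵇ 0) ∣σ∣)) , no-out , no-in) , σₙ
      where
      σₙ : IsNSimplex X n σ
      σₙ = zₙ σ zσ
      σ∈X : isFace X σ ≡ true
      σ∈X = proj₁ σₙ
      ∣σ∣ : ∣ σ ∣ ≡ suc n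
      ∣σ∣ = proj₂ σₙ
      no-out : ¬ (∃[ τ ] InI X ε σ τ)
      no-out (τ , σ→τ) with () ← trans (sym zσ) (cycle-vanishes-on-sources (chain⇒faceChain zₙ) z-cycle σ→τ)
      no-in : ¬ (∃[ ρ ] InI X ε ρ σ)
      no-in (ρ , ρ→σ) with () ← trans (sym zσ) (trans (sym (∂h∘δh-matched {z} ρ→σ)) ∂δzσ)
    ... | false | true with () ← trans (sym zσ) (∂h∘δh-true {z} ∂δzσ)

corollary3p6 : ∀ {m} (X : SimplicialComplex m) (ε : Colouring m) → Dalmatian X ε →
    ∀ (n : ℕ) →
    (∀ σ → Critical X ε σ → IsNSimplex X n σ → IsCycle ε ⟦ σ ⟧)
    × (∀ (z : Chain m) → IsChain X n z → IsCycle ε z →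
    Σ (Chain m) λ a → ((∀ σ → a σ ≡ true → Critical X ε σ × IsNSimplex X n σ)
    × Σ (Chain m) λ w → (IsChain X (suc n) w × (∀ τ → z τ ≡ (a ⊕ ∂h ε w) τ))))
    × (∀ (a : Chain m) → (∀ σ → a σ ≡ true → Critical X ε σ × IsNSimplex X n σ) →
    ∀ (w : Chain m) → IsChain X (suc n) w → (∀ τ → a τ ≡ ∂h ε w τ) →
    ∀ σ → a σ ≡ false)
corollary3p6 X ε D n =
    (λ σ σ-critical _ → critical⇒cycle X ε σ-critical)
  , (λ z zₙ z-cycle → let ∂δz = ∂h ε (δh X ε z) in
       z ⊕ ∂δz , (λ σ → cycle+∂δh-critical X ε D zₙ z-cycle) ,
       δh X ε z , δh-chain X ε zₙ , ⊕-cancelʳ z ∂δz)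
  , λ a a-critical w wₙ a≡∂w σ → ¬-not λ aσ →
      boundary⇒not-critical X ε (chain⇒faceChain X ε wₙ) (trans (sym (a≡∂w σ)) aσ) (proj₁ (a-critical σ aσ))
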